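{- Let $n \ge 3$ and let $N$ be the matroid obtained from the uniform matroid $U_{2,n}$ by replacing each element by a pair of parallel elements. Let $M$ be the dual of $N$. Then $M$ has a unique minimal tropical basis.
   Context: For a simple matroid $M$ on ground set $E$ with closure operator $\operatorname{cl}$ and set of circuits $\mathcal{C}$, a subset $\mathcal{C}' \subseteq \mathcal{C}$ is a tropical basis of $M$ if for every $X \subseteq E$ with $X \neq \operatorname{cl}(X)$ there exists $C \in \mathcal{C}'$ with $|C \setminus X| = 1$. A tropical basis $\mathcal{C}'$ is minimal if for every $C \in \mathcal{C}'$ the family $\mathcal{C}' \setminus \{C\}$ is not a tropical basis. -}

module Defs where

open import Data.Nat using (ℕ; zero; suc; _+_; _*_; _∸_; _⊓_; _<_; _≥_)
open import Data.Nat.Properties using (_≟_)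
open import Data.Bool using (Bool; true; false; _∨_)
open import Data.Fin using (Fin; combine) renaming (zero to fz; suc to fs)
open import Data.Fin.Subset using (Subset; ∣_∣; _∪_; _─_; ⁅_⁆; _⊂_; ∁; ⊤)
open import Data.Vec using (tabulate; lookup)
open import Data.Product using (Σ; _×_; ∃)
open import Relation.Binary.PropositionalEquality using (_≡_; _≢_)
open import Relation.Nullary using (¬_)
open import Relation.Nullary.Decidable using (⌊_⌋)
open import Function.Bundles using (_⇔_)

module MatroidNotions {m : ℕ} (r : Subset m → ℕ) where

  cl : Subset m → Subset m
  cl X = tabulate (λ e → ⌊ r (X ∪ ⁅ e ⁆) ≟ r X ⌋)

  Dependent : Subset m → Set
  Dependent X = r X < ∣ X ∣

  IsCircuit : Subset m → Set
  IsCircuit C = Dependent C × (∀ Y → Y ⊂ C → ¬ Dependent Y)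

  Family : Set₁
  Family = Subset m → Set

  IsTropicalBasis : Family → Set
  IsTropicalBasis C' =
    (∀ C → C' C → IsCircuit C) ×
    (∀ X → X ≢ cl X → ∃ λ C → C' C × ∣ C ─ X ∣ ≡ 1)

  remove : Family → Subset m → Family
  remove C' C D = C' D × D ≢ C

  IsMinimalTropicalBasis : Family → Set
  IsMinimalTropicalBasis C' =
    IsTropicalBasis C' × (∀ C → C' C → ¬ IsTropicalBasis (remove C' C))

  HasUniqueMinimalTropicalBasis : Set₁
  HasUniqueMinimalTropicalBasis =
    Σ Family λ C' → IsMinimalTropicalBasis C' ×
      (∀ C'' → IsMinimalTropicalBasis C'' → ∀ X → C'' X ⇔ C' X)

-- N = U_{2,n} with every element replaced by a parallel pair.
-- Ground set Fin (n * 2); element  combine i b  (i : Fin n, b : Fin 2)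
-- is the b-th copy of element i of U_{2,n}.

classesHit : (n : ℕ) → Subset (n * 2) → Subset n
classesHit n Y = tabulate (λ i → lookup Y (combine i fz) ∨ lookup Y (combine i (fs fz)))

-- rank in N: rank in U_{2,n} of the set of classes met
rankN : (n : ℕ) → Subset (n * 2) → ℕ
rankN n Y = 2 ⊓ ∣ classesHit n Y ∣

-- M = N*: r*(X) = |X| + r_N(E ∖ X) - r_N(E)
rankM : (n : ℕ) → Subset (n * 2) → ℕ
rankM n X = (∣ X ∣ + rankN n (∁ X)) ∸ rankN n ⊤

-- Call a parallel class incomplete in X if X does not contain it, and let k be the
-- number of such classes. Then r_M(X) = |X| + min(2, k) - 2, so X is dependent iff
-- k ≤ 1, and the circuits of M are exactly the complements C_i of single classes.
-- The circuits form a tropical basis: if e ∈ cl(X) ∖ X, then X ∪ {e} has at most one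
-- incomplete class j, which is not the class of e, and C_j ∖ X = {e}. Every tropical
-- basis contains every C_i: for Y = C_i minus one element, Y is not closed, and C_i is
-- the only circuit with |C ∖ Y| = 1 because any other C_j contains both elements of
-- class i. Hence the set of all circuits is the unique minimal tropical basis. The
-- argument only needs n ≥ 2.

module Submission where

open import Defs
open import Data.Nat using (ℕ; zero; suc; s≤s⁻¹; _+_; _*_; _∸_; _⊓_; _≤_; _<_; _≥_; z≤n; s≤s; _≤?_)
open import Data.Nat.Properties
  using (+-comm; +-suc; +-monoʳ-≤; +-cancelˡ-≡; +-cancelʳ-≡; m≤m+n; m≤n+m; m∸n+n≡m; m≤n⇒m⊓n≡m;
         ≤-trans; ≤-reflexive; <⇒≢; <⇒≱; ≰⇒>; module ≤-Reasoning)
open import Data.Bool using (Bool; T)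
open import Data.Bool.Properties using (T-≡; T-∨)
open import Data.Fin using (Fin; combine; quotient; punchIn) renaming (zero to fz; suc to fs)
open import Data.Fin.Properties
  using (remQuot-combine; combine-surjective; combine-injectiveʳ; punchInᵢ≢i; ¬∀⟶∃¬)
  renaming (_≟_ to _≟ᶠ_)
open import Data.Fin.Subset
open import Data.Fin.Subset.Properties
open import Data.Vec using (_∷_; here; there; lookup; tabulate)
open import Data.Vec.Properties using (lookup∘tabulate; []=⇒lookup; lookup⇒[]=)
open import Data.Product as Product using (∃; _×_; _,_; proj₁; proj₂)
open import Data.Sum using (_⊎_; inj₁; inj₂; [_,_])
open import Function using (_∘_)
open import Function.Bundles using (_⇔_; mk⇔; Equivalence)
open import Relation.Binary.PropositionalEquality
  using (_≡_; _≢_; refl; sym; trans; cong; cong₂; subst; module ≡-Reasoning)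
open import Relation.Nullary using (¬_; yes; no; contradiction)
open import Relation.Nullary.Decidable
  using (⌊_⌋; decidable-stable; toWitness; fromWitness; _→-dec_; ¬?)

private
  variable
    m : ℕ

x∈p─q⇒x∈p×x∉q : ∀ {x : Fin m} (p q : Subset m) → x ∈ p ─ q → x ∈ p × x ∉ q
x∈p─q⇒x∈p×x∉q (_ ∷ _) (outside ∷ _) here = here , λ ()
x∈p─q⇒x∈p×x∉q (_ ∷ p) (_ ∷ q) (there x∈p─q) =
  Product.map there (_∘ drop-there) (x∈p─q⇒x∈p×x∉q p q x∈p─q)

x∈p⇒⁅x⁆⊆p : ∀ {x : Fin m} {p} → x ∈ p → ⁅ x ⁆ ⊆ p
x∈p⇒⁅x⁆⊆p {x = x} x∈p y∈⁅x⁆ = subst (_∈ _) (sym (x∈⁅y⁆⇒x≡y x y∈⁅x⁆)) x∈p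

x∈p∧y∈p∧x≢y⇒2≤∣p∣ : ∀ {x y : Fin m} {p} → x ∈ p → y ∈ p → x ≢ y → 2 ≤ ∣ p ∣
x∈p∧y∈p∧x≢y⇒2≤∣p∣ {x = x} {y} {p} x∈p y∈p x≢y = begin
  2              ≡⟨ cong suc (sym (∣⁅x⁆∣≡1 y)) ⟩
  suc ∣ ⁅ y ⁆ ∣  ≤⟨ s≤s (p⊆q⇒∣p∣≤∣q∣ (x∈p⇒⁅x⁆⊆p (x∈p∧x≢y⇒x∈p-y y∈p (x≢y ∘ sym)))) ⟩
  suc ∣ p - x ∣  ≤⟨ x∈p⇒∣p-x∣<∣p∣ x∈p ⟩
  ∣ p ∣          ∎
  where open ≤-Reasoning

∣p∣≤1∧x∈p⇒p⊆⁅x⁆ : ∀ {x : Fin m} {p} → ∣ p ∣ ≤ 1 → x ∈ p → p ⊆ ⁅ x ⁆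
∣p∣≤1∧x∈p⇒p⊆⁅x⁆ {x = x} ∣p∣≤1 x∈p {y} y∈p with y ≟ᶠ x
... | yes refl = x∈⁅x⁆ x
... | no y≢x = contradiction ∣p∣≤1 (<⇒≱ (x∈p∧y∈p∧x≢y⇒2≤∣p∣ y∈p x∈p y≢x))

Empty⇒⊆ : ∀ {p q : Subset m} → Empty p → p ⊆ q
Empty⇒⊆ ¬∃ x∈p = contradiction (_ , x∈p) ¬∃

∣p∣≤1⇒∃p⊆⁅y⁆ : ∀ {p : Subset (suc m)} → ∣ p ∣ ≤ 1 → ∃ λ y → p ⊆ ⁅ y ⁆
∣p∣≤1⇒∃p⊆⁅y⁆ {p = p} ∣p∣≤1 with nonempty? p
... | yes (y , y∈p) = y , ∣p∣≤1∧x∈p⇒p⊆⁅x⁆ ∣p∣≤1 y∈p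
... | no p-empty = fz , Empty⇒⊆ p-empty

∣p∣≤1⇒∃∉ : ∀ {p : Subset (suc (suc m))} → ∣ p ∣ ≤ 1 → ∃ λ x → x ∉ p
∣p∣≤1⇒∃∉ ∣p∣≤1 with y , p⊆⁅y⁆ ← ∣p∣≤1⇒∃p⊆⁅y⁆ ∣p∣≤1 =
  punchIn y fz , λ x∈p → punchInᵢ≢i y fz (x∈⁅y⁆⇒x≡y y (p⊆⁅y⁆ x∈p))

∣p∣≤1∧x∉p⇒∃y≢x∧p⊆⁅y⁆ : ∀ {x : Fin (suc (suc m))} {p} → ∣ p ∣ ≤ 1 → x ∉ p →
                        ∃ λ y → x ≢ y × p ⊆ ⁅ y ⁆
∣p∣≤1∧x∉p⇒∃y≢x∧p⊆⁅y⁆ {x = x} {p} ∣p∣≤1 x∉p with nonempty? p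
... | yes (y , y∈p) = y , (λ { refl → x∉p y∈p }) , ∣p∣≤1∧x∈p⇒p⊆⁅x⁆ ∣p∣≤1 y∈p
... | no p-empty = punchIn x fz , punchInᵢ≢i x fz ∘ sym , Empty⇒⊆ p-empty

p⊆q∧p⊄q⇒p≡q : ∀ {p q : Subset m} → p ⊆ q → p ⊄ q → p ≡ q
p⊆q∧p⊄q⇒p≡q {p = p} {q} p⊆q p⊄q = ⊆-antisym {i = p} {q} p⊆q q⊆p
  where
  q⊆p : q ⊆ p
  q⊆p {x} x∈q with x ∈? p
  ... | yes x∈p = x∈p
  ... | no x∉p = contradiction ((λ {y} → p⊆q {y}) , x , x∈q , x∉p) p⊄q

x∈p⇒p∪⁅x⁆≡p : ∀ {x : Fin m} {p} → x ∈ p → p ∪ ⁅ x ⁆ ≡ p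
x∈p⇒p∪⁅x⁆≡p {p = p} x∈p = ⊆-antisym
  (λ y∈ → [ (λ y∈p → y∈p) , (λ y∈⁅x⁆ → x∈p⇒⁅x⁆⊆p x∈p y∈⁅x⁆) ] (x∈p∪q⁻ p _ y∈))
  (p⊆p∪q _)

x∈p⇒p-x∪⁅x⁆≡p : ∀ {x : Fin m} {p} → x ∈ p → (p - x) ∪ ⁅ x ⁆ ≡ p
x∈p⇒p-x∪⁅x⁆≡p {x = x} {p} x∈p = ⊆-antisym
  (λ y∈ → [ proj₁ ∘ x∈p─q⇒x∈p×x∉q p _ , x∈p⇒⁅x⁆⊆p x∈p ] (x∈p∪q⁻ (p - x) _ y∈))
  split
  where
  split : p ⊆ (p - x) ∪ ⁅ x ⁆
  split {y} y∈p with y ≟ᶠ x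
  ... | yes refl = q⊆p∪q (p - x) _ (x∈⁅x⁆ x)
  ... | no y≢x = p⊆p∪q _ (x∈p∧x≢y⇒x∈p-y y∈p y≢x)

x∉p⇒∣p∪⁅x⁆∣≡1+∣p∣ : ∀ {x : Fin m} {p} → x ∉ p → ∣ p ∪ ⁅ x ⁆ ∣ ≡ suc ∣ p ∣
x∉p⇒∣p∪⁅x⁆∣≡1+∣p∣ {x = fz} {outside ∷ p} _ = cong (suc ∘ ∣_∣) (∪-identityʳ p)
x∉p⇒∣p∪⁅x⁆∣≡1+∣p∣ {x = fz} {inside ∷ p} x∉p = contradiction here x∉p
x∉p⇒∣p∪⁅x⁆∣≡1+∣p∣ {x = fs x} {outside ∷ p} x∉p = x∉p⇒∣p∪⁅x⁆∣≡1+∣p∣ (x∉p ∘ there)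
x∉p⇒∣p∪⁅x⁆∣≡1+∣p∣ {x = fs x} {inside ∷ p} x∉p = cong suc (x∉p⇒∣p∪⁅x⁆∣≡1+∣p∣ (x∉p ∘ there))

m+2≡n+t∧t≤1⇒m<n : ∀ {m n t} → m + 2 ≡ n + t → t ≤ 1 → m < n
m+2≡n+t∧t≤1⇒m<n {m} {n} {t} eq t≤1 = s≤s⁻¹ (begin
  suc (suc m) ≡⟨ +-comm 2 m ⟩
  m + 2       ≡⟨ eq ⟩
  n + t       ≤⟨ +-monoʳ-≤ n t≤1 ⟩
  n + 1       ≡⟨ +-comm n 1 ⟩
  suc n       ∎)
  where open ≤-Reasoning

m+2≡n+2⊓k⇒[m<n⇔k≤1] : ∀ {m n} k → m + 2 ≡ n + 2 ⊓ k → m < n ⇔ k ≤ 1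
m+2≡n+2⊓k⇒[m<n⇔k≤1] zero eq = mk⇔ (λ _ → z≤n) (λ _ → m+2≡n+t∧t≤1⇒m<n eq z≤n)
m+2≡n+2⊓k⇒[m<n⇔k≤1] (suc zero) eq = mk⇔ (λ _ → s≤s z≤n) (λ _ → m+2≡n+t∧t≤1⇒m<n eq (s≤s z≤n))
m+2≡n+2⊓k⇒[m<n⇔k≤1] {m} {n} (suc (suc _)) eq =
  mk⇔ (λ m<n → contradiction (+-cancelʳ-≡ 2 m n eq) (<⇒≢ m<n)) (λ { (s≤s ()) })

suc[2⊓k′]≡2⊓k⇒k′≤1∧k′<k : ∀ k k′ → suc (2 ⊓ k′) ≡ 2 ⊓ k → k′ ≤ 1 × k′ < k
suc[2⊓k′]≡2⊓k⇒k′≤1∧k′<k (suc zero) zero refl = z≤n , s≤s z≤n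
suc[2⊓k′]≡2⊓k⇒k′≤1∧k′<k (suc (suc _)) (suc zero) refl = s≤s z≤n , s≤s (s≤s z≤n)
suc[2⊓k′]≡2⊓k⇒k′≤1∧k′<k zero _ ()
suc[2⊓k′]≡2⊓k⇒k′≤1∧k′<k (suc zero) (suc _) ()
suc[2⊓k′]≡2⊓k⇒k′≤1∧k′<k (suc (suc _)) zero ()
suc[2⊓k′]≡2⊓k⇒k′≤1∧k′<k (suc (suc _)) (suc (suc _)) ()

∈⇔T-lookup : ∀ {x : Fin m} {p} → x ∈ p ⇔ T (lookup p x)
∈⇔T-lookup {x = x} {p} =
  mk⇔ (Equivalence.from T-≡ ∘ []=⇒lookup) (lookup⇒[]= x p ∘ Equivalence.to T-≡)

∈-tabulate : ∀ {f : Fin m → Bool} {x} → x ∈ tabulate f ⇔ T (f x)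
∈-tabulate {f = f} {x} = subst (λ b → x ∈ tabulate f ⇔ T b) (lookup∘tabulate f x) ∈⇔T-lookup

module _ {m : ℕ} (r : Subset m → ℕ) where
  open MatroidNotions r

  ∈cl⇔ : ∀ {X e} → e ∈ cl X ⇔ r (X ∪ ⁅ e ⁆) ≡ r X
  ∈cl⇔ = mk⇔ (toWitness ∘ Equivalence.to ∈-tabulate) (Equivalence.from ∈-tabulate ∘ fromWitness)

  X⊆clX : ∀ {X} → X ⊆ cl X
  X⊆clX x∈X = Equivalence.from ∈cl⇔ (cong r (x∈p⇒p∪⁅x⁆≡p x∈X))

  X≢clX⇒∃e∈clX∖X : ∀ {X} → X ≢ cl X → ∃ λ e → e ∈ cl X × e ∉ X
  X≢clX⇒∃e∈clX∖X {X} X≢clX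
    with e , clX↛X ← ¬∀⟶∃¬ m (λ e → e ∈ cl X → e ∈ X) (λ e → e ∈? cl X →-dec e ∈? X)
                      (λ clX⊆X → X≢clX (⊆-antisym {i = X} X⊆clX (clX⊆X _)))
    with e ∈? cl X
  ... | yes e∈clX = e , e∈clX , λ e∈X → clX↛X (λ _ → e∈X)
  ... | no e∉clX = contradiction (λ e∈clX → contradiction e∈clX e∉clX) clX↛X

  Essential : Subset m → Set
  Essential C = ∃ λ Y → Y ≢ cl Y × (∀ D → IsCircuit D → ∣ D ─ Y ∣ ≡ 1 → D ≡ C)

  essential∈tropicalBasis : ∀ {𝒞 C} → IsTropicalBasis 𝒞 → Essential C → 𝒞 C
  essential∈tropicalBasis {𝒞} (𝒞⊆circuits , detects) (Y , Y≢clY , only-C)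
    with D , D∈𝒞 , ∣D─Y∣≡1 ← detects Y Y≢clY =
    subst 𝒞 (only-C D (𝒞⊆circuits D D∈𝒞) ∣D─Y∣≡1) D∈𝒞

  circuits-uniqueMinimalTropicalBasis :
    IsTropicalBasis IsCircuit → (∀ C → IsCircuit C → Essential C) → HasUniqueMinimalTropicalBasis
  circuits-uniqueMinimalTropicalBasis basis essential =
    IsCircuit , (basis , minimal) , unique
    where
    minimal : ∀ C → IsCircuit C → ¬ IsTropicalBasis (remove IsCircuit C)
    minimal C C-circuit basis′ = proj₂ (essential∈tropicalBasis basis′ (essential C C-circuit)) refl

    unique : ∀ 𝒞 → IsMinimalTropicalBasis 𝒞 → ∀ X → 𝒞 X ⇔ IsCircuit X
    unique 𝒞 (basis′ , _) X =
      mk⇔ (proj₁ basis′ X) (λ X-circuit → essential∈tropicalBasis basis′ (essential X X-circuit))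

module ParallelClasses (n : ℕ) where

  classOf : Fin (n * 2) → Fin n
  classOf = quotient 2

  classOf-combine : ∀ (c : Fin n) b → classOf (combine c b) ≡ c
  classOf-combine c b = cong proj₁ (remQuot-combine c b)

  combine-0≢combine-1 : ∀ (c : Fin n) → combine c fz ≢ combine {n = 2} c (fs fz)
  combine-0≢combine-1 c eq with () ← combine-injectiveʳ c fz c (fs fz) eq

  ∈-classesHit⁺ : ∀ {Y : Subset (n * 2)} {x} → x ∈ Y → classOf x ∈ classesHit n Y
  ∈-classesHit⁺ {Y} {x} x∈Y with combine-surjective {n} {2} x
  ... | c , b , refl = subst (_∈ classesHit n Y) (sym (classOf-combine c b))
    (Equivalence.from ∈-tabulate (Equivalence.from T-∨ (side b (Equivalence.to ∈⇔T-lookup x∈Y))))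
    where
    side : ∀ b → T (lookup Y (combine c b)) →
           T (lookup Y (combine c fz)) ⊎ T (lookup Y (combine c (fs fz)))
    side fz = inj₁
    side (fs fz) = inj₂

  ∈-classesHit⁻ : ∀ {Y : Subset (n * 2)} {c} → c ∈ classesHit n Y → ∃ λ x → classOf x ≡ c × x ∈ Y
  ∈-classesHit⁻ {Y = Y} {c} c∈ =
    [ member fz , member (fs fz) ] (Equivalence.to T-∨ (Equivalence.to ∈-tabulate c∈))
    where
    member : ∀ b → T (lookup Y (combine c b)) → ∃ λ x → classOf x ≡ c × x ∈ Y
    member b t = combine c b , classOf-combine c b , Equivalence.from ∈⇔T-lookup t

  classesHit-⊤ : classesHit n ⊤ ≡ ⊤
  classesHit-⊤ = ⊆-antisym ⊆⊤ (λ {c} _ → subst (_∈ _) (classOf-combine c fz) (∈-classesHit⁺ ∈⊤))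

  -- The classes met by E ∖ X, so that rankN n (∁ X) is 2 ⊓ ∣ incomplete X ∣.
  incomplete : Subset (n * 2) → Subset n
  incomplete X = classesHit n (∁ X)

  ∉⇒classOf∈incomplete : ∀ {X : Subset (n * 2)} {x} → x ∉ X → classOf x ∈ incomplete X
  ∉⇒classOf∈incomplete x∉X = ∈-classesHit⁺ (x∉p⇒x∈∁p x∉X)

  ∈incomplete⇒∃∉ : ∀ {X : Subset (n * 2)} {c} → c ∈ incomplete X → ∃ λ x → classOf x ≡ c × x ∉ X
  ∈incomplete⇒∃∉ c∈ = Product.map₂ (Product.map₂ x∈∁p⇒x∉p) (∈-classesHit⁻ c∈)

  ∉incomplete⇒∈ : ∀ {X : Subset (n * 2)} {c} b → c ∉ incomplete X → combine c b ∈ X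
  ∉incomplete⇒∈ {X} {c} b c∉ with combine c b ∈? X
  ... | yes cb∈X = cb∈X
  ... | no cb∉X = contradiction (subst (_∈ _) (classOf-combine c b) (∉⇒classOf∈incomplete cb∉X)) c∉

  ∈incomplete-∪⁅⁆ : ∀ {X : Subset (n * 2)} {e} {c : Fin n} → c ∈ incomplete X → c ≢ classOf e →
                    c ∈ incomplete (X ∪ ⁅ e ⁆)
  ∈incomplete-∪⁅⁆ {X = X} {e} c∈ c≢classOf-e with x , x∈c , x∉X ← ∈incomplete⇒∃∉ {X = X} c∈ =
    subst (_∈ _) x∈c (∉⇒classOf∈incomplete λ x∈X∪⁅e⁆ →
      [ x∉X , (λ x∈⁅e⁆ → c≢classOf-e (trans (sym x∈c) (cong classOf (x∈⁅y⁆⇒x≡y e x∈⁅e⁆)))) ]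
        (x∈p∪q⁻ X _ x∈X∪⁅e⁆))

  -- The complement of a hyperplane of N, hence a circuit of M = N*.
  classComplement : Fin n → Subset (n * 2)
  classComplement i = tabulate (λ x → ⌊ ¬? (classOf x ≟ᶠ i) ⌋)

  ∈classComplement⇔ : ∀ {i : Fin n} {x} → x ∈ classComplement i ⇔ classOf x ≢ i
  ∈classComplement⇔ =
    mk⇔ (toWitness ∘ Equivalence.to ∈-tabulate) (Equivalence.from ∈-tabulate ∘ fromWitness)

  combine∉classComplement : ∀ (i : Fin n) b → combine i b ∉ classComplement i
  combine∉classComplement i b ∈C = Equivalence.to ∈classComplement⇔ ∈C (classOf-combine i b)

  combine∈classComplement : ∀ {i j : Fin n} b → i ≢ j → combine i b ∈ classComplement j
  combine∈classComplement {i = i} b i≢j =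
    Equivalence.from ∈classComplement⇔ (i≢j ∘ trans (sym (classOf-combine i b)))

  ⊆classComplement⇒∈incomplete : ∀ {X} {i : Fin n} → X ⊆ classComplement i → i ∈ incomplete X
  ⊆classComplement⇒∈incomplete {i = i} X⊆C = subst (_∈ _) (classOf-combine i fz)
    (∉⇒classOf∈incomplete (combine∉classComplement i fz ∘ X⊆C))

  incomplete⊆⁅i⁆⇒classComplement⊆ : ∀ {X} {i : Fin n} → incomplete X ⊆ ⁅ i ⁆ → classComplement i ⊆ X
  incomplete⊆⁅i⁆⇒classComplement⊆ {X = X} {i} inc⊆⁅i⁆ {x} x∈C with x ∈? X
  ... | yes x∈X = x∈X
  ... | no x∉X = contradiction (x∈⁅y⁆⇒x≡y i (inc⊆⁅i⁆ (∉⇒classOf∈incomplete x∉X)))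
                              (Equivalence.to ∈classComplement⇔ x∈C)

  incomplete-classComplement : ∀ (i : Fin n) → incomplete (classComplement i) ≡ ⁅ i ⁆
  incomplete-classComplement i =
    ⊆-antisym ⊆⁅i⁆ (x∈p⇒⁅x⁆⊆p (⊆classComplement⇒∈incomplete (λ x∈ → x∈)))
    where
    ⊆⁅i⁆ : incomplete (classComplement i) ⊆ ⁅ i ⁆
    ⊆⁅i⁆ c∈ with x , refl , x∉C ← ∈incomplete⇒∃∉ c∈ with classOf x ≟ᶠ i
    ... | yes refl = x∈⁅x⁆ _
    ... | no x≢i = contradiction (Equivalence.from ∈classComplement⇔ x≢i) x∉C

  classComplement─X≡⁅e⁆ : ∀ {X : Subset (n * 2)} {e} {j : Fin n} → e ∉ X → classOf e ≢ j →
                          incomplete (X ∪ ⁅ e ⁆) ⊆ ⁅ j ⁆ → classComplement j ─ X ≡ ⁅ e ⁆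
  classComplement─X≡⁅e⁆ {X = X} {e} {j} e∉X classOf-e≢j inc⊆⁅j⁆ = ⊆-antisym ⊆⁅e⁆ ⁅e⁆⊆
    where
    ⊆⁅e⁆ : classComplement j ─ X ⊆ ⁅ e ⁆
    ⊆⁅e⁆ {y} y∈ with y∈C , y∉X ← x∈p─q⇒x∈p×x∉q _ X y∈ with y ≟ᶠ e
    ... | yes refl = x∈⁅x⁆ e
    ... | no y≢e = contradiction
      (x∈⁅y⁆⇒x≡y j (inc⊆⁅j⁆ (∉⇒classOf∈incomplete
        (λ y∈X∪⁅e⁆ → [ y∉X , x≢y⇒x∉⁅y⁆ y≢e ] (x∈p∪q⁻ X _ y∈X∪⁅e⁆)))))
      (Equivalence.to ∈classComplement⇔ y∈C)
    ⁅e⁆⊆ : ⁅ e ⁆ ⊆ classComplement j ─ X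
    ⁅e⁆⊆ y∈⁅e⁆ rewrite x∈⁅y⁆⇒x≡y e y∈⁅e⁆ =
      x∈p∧x∉q⇒x∈p─q (Equivalence.from ∈classComplement⇔ classOf-e≢j) e∉X

module DoubledDualUniform (m : ℕ) where

  n : ℕ
  n = 2 + m

  open ParallelClasses n
  open MatroidNotions (rankM n)

  2≤∣X∣+2⊓∣incompleteX∣ : ∀ X → 2 ≤ ∣ X ∣ + 2 ⊓ ∣ incomplete X ∣
  2≤∣X∣+2⊓∣incompleteX∣ X with ∣ incomplete X ∣ ≤? 1
  ... | no k≰1 = ≤-trans (≤-reflexive (sym (m≤n⇒m⊓n≡m (≰⇒> k≰1)))) (m≤n+m _ ∣ X ∣)
  ... | yes k≤1 with c , c∉ ← ∣p∣≤1⇒∃∉ k≤1 = ≤-trans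
    (x∈p∧y∈p∧x≢y⇒2≤∣p∣ (∉incomplete⇒∈ {X} fz c∉) (∉incomplete⇒∈ {X} (fs fz) c∉)
                       (combine-0≢combine-1 c))
    (m≤m+n ∣ X ∣ _)

  -- Shifted by 2 on both sides to get rid of the truncated subtraction in rankM.
  rankM-+2 : ∀ X → rankM n X + 2 ≡ ∣ X ∣ + 2 ⊓ ∣ incomplete X ∣
  rankM-+2 X =
    trans (cong (λ H → (∣ X ∣ + 2 ⊓ ∣ incomplete X ∣) ∸ 2 ⊓ ∣ H ∣ + 2) classesHit-⊤)
          (m∸n+n≡m (2≤∣X∣+2⊓∣incompleteX∣ X))

  Dependent⇔∣incomplete∣≤1 : ∀ X → Dependent X ⇔ ∣ incomplete X ∣ ≤ 1
  Dependent⇔∣incomplete∣≤1 X = m+2≡n+2⊓k⇒[m<n⇔k≤1] _ (rankM-+2 X)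

  classComplement-isCircuit : ∀ i → IsCircuit (classComplement i)
  classComplement-isCircuit i =
    Equivalence.from (Dependent⇔∣incomplete∣≤1 (classComplement i))
      (≤-reflexive (trans (cong ∣_∣ (incomplete-classComplement i)) (∣⁅x⁆∣≡1 i))) ,
    properSubset-independent
    where
    properSubset-independent : ∀ Y → Y ⊂ classComplement i → ¬ Dependent Y
    properSubset-independent Y (Y⊆C , x , x∈C , x∉Y) Y-dependent = <⇒≱
      (x∈p∧y∈p∧x≢y⇒2≤∣p∣ (∉⇒classOf∈incomplete x∉Y) (⊆classComplement⇒∈incomplete Y⊆C)
                         (Equivalence.to ∈classComplement⇔ x∈C))
      (Equivalence.to (Dependent⇔∣incomplete∣≤1 Y) Y-dependent)

  isCircuit⇒≡classComplement : ∀ {C} → IsCircuit C → ∃ λ i → C ≡ classComplement i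
  isCircuit⇒≡classComplement {C} (C-dependent , C-minimal)
    with i , inc⊆⁅i⁆ ← ∣p∣≤1⇒∃p⊆⁅y⁆ (Equivalence.to (Dependent⇔∣incomplete∣≤1 C) C-dependent) =
    i , sym (p⊆q∧p⊄q⇒p≡q (incomplete⊆⁅i⁆⇒classComplement⊆ inc⊆⁅i⁆)
                         (λ C′⊂C → C-minimal _ C′⊂C (proj₁ (classComplement-isCircuit i))))

  -- Adding a spanned e lowers 2 ⊓ ∣ incomplete ∣ by one: so at most one class stays
  -- incomplete, and the class of e is not among them.
  spanned⇒incomplete⊆⁅j⁆ : ∀ X {e} → e ∉ X → rankM n (X ∪ ⁅ e ⁆) ≡ rankM n X →
                           ∃ λ j → classOf e ≢ j × incomplete (X ∪ ⁅ e ⁆) ⊆ ⁅ j ⁆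
  spanned⇒incomplete⊆⁅j⁆ X {e} e∉X same-rank = ∣p∣≤1∧x∉p⇒∃y≢x∧p⊆⁅y⁆ k′≤1 classOf-e∉
    where
    k k′ : ℕ
    k = ∣ incomplete X ∣
    k′ = ∣ incomplete (X ∪ ⁅ e ⁆) ∣

    step : suc (2 ⊓ k′) ≡ 2 ⊓ k
    step = +-cancelˡ-≡ ∣ X ∣ _ _ (begin
      ∣ X ∣ + suc (2 ⊓ k′)     ≡⟨ +-suc ∣ X ∣ _ ⟩
      suc ∣ X ∣ + 2 ⊓ k′       ≡⟨ cong (_+ 2 ⊓ k′) (sym (x∉p⇒∣p∪⁅x⁆∣≡1+∣p∣ e∉X)) ⟩
      ∣ X ∪ ⁅ e ⁆ ∣ + 2 ⊓ k′   ≡⟨ sym (rankM-+2 (X ∪ ⁅ e ⁆)) ⟩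
      rankM n (X ∪ ⁅ e ⁆) + 2  ≡⟨ cong (_+ 2) same-rank ⟩
      rankM n X + 2            ≡⟨ rankM-+2 X ⟩
      ∣ X ∣ + 2 ⊓ k            ∎)
      where open ≡-Reasoning

    k′≤1 : k′ ≤ 1
    k′≤1 = proj₁ (suc[2⊓k′]≡2⊓k⇒k′≤1∧k′<k k k′ step)

    k′<k : k′ < k
    k′<k = proj₂ (suc[2⊓k′]≡2⊓k⇒k′≤1∧k′<k k k′ step)

    classOf-e∉ : classOf e ∉ incomplete (X ∪ ⁅ e ⁆)
    classOf-e∉ classOf-e∈ = <⇒≱ k′<k (p⊆q⇒∣p∣≤∣q∣ incomplete-grows)
      where
      incomplete-grows : incomplete X ⊆ incomplete (X ∪ ⁅ e ⁆)
      incomplete-grows {c} c∈ with c ≟ᶠ classOf e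
      ... | yes refl = classOf-e∈
      ... | no c≢classOf-e = ∈incomplete-∪⁅⁆ {X} c∈ c≢classOf-e

  circuits-isTropicalBasis : IsTropicalBasis IsCircuit
  circuits-isTropicalBasis = (λ _ C-circuit → C-circuit) , detect
    where
    detect : ∀ X → X ≢ cl X → ∃ λ C → IsCircuit C × ∣ C ─ X ∣ ≡ 1
    detect X X≢clX =
      let e , e∈clX , e∉X = X≢clX⇒∃e∈clX∖X (rankM n) {X} X≢clX
          j , classOf-e≢j , inc⊆⁅j⁆ =
            spanned⇒incomplete⊆⁅j⁆ X e∉X (Equivalence.to (∈cl⇔ (rankM n) {X}) e∈clX)
      in classComplement j , classComplement-isCircuit j ,
         trans (cong ∣_∣ (classComplement─X≡⁅e⁆ {X} e∉X classOf-e≢j inc⊆⁅j⁆)) (∣⁅x⁆∣≡1 e)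

  classComplement-essential : ∀ i → Essential (rankM n) (classComplement i)
  classComplement-essential i = Y , Y≢clY , only-C
    where
    C : Subset (n * 2)
    C = classComplement i
    e : Fin (n * 2)
    e = combine {n = 2} (punchIn i fz) fz

    e∈C : e ∈ C
    e∈C = combine∈classComplement fz (punchInᵢ≢i i fz)

    Y : Subset (n * 2)
    Y = C - e

    Y⊆C : Y ⊆ C
    Y⊆C = p─q⊆p C ⁅ e ⁆

    e∉Y : e ∉ Y
    e∉Y e∈Y = proj₂ (x∈p─q⇒x∈p×x∉q C ⁅ e ⁆ e∈Y) (x∈⁅x⁆ e)

    same-rank : rankM n (Y ∪ ⁅ e ⁆) ≡ rankM n Y
    same-rank = +-cancelʳ-≡ 2 _ _ (begin
      rankM n (Y ∪ ⁅ e ⁆) + 2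
        ≡⟨ cong (λ Z → rankM n Z + 2) (x∈p⇒p-x∪⁅x⁆≡p e∈C) ⟩
      rankM n C + 2
        ≡⟨ rankM-+2 C ⟩
      ∣ C ∣ + 2 ⊓ ∣ incomplete C ∣
        ≡⟨ cong₂ (λ Z W → ∣ Z ∣ + 2 ⊓ ∣ W ∣)
                 (sym (x∈p⇒p-x∪⁅x⁆≡p e∈C)) (incomplete-classComplement i) ⟩
      ∣ Y ∪ ⁅ e ⁆ ∣ + 2 ⊓ ∣ ⁅ i ⁆ ∣
        ≡⟨ cong₂ (λ a b → a + 2 ⊓ b) (x∉p⇒∣p∪⁅x⁆∣≡1+∣p∣ e∉Y) (∣⁅x⁆∣≡1 i) ⟩
      suc ∣ Y ∣ + 1
        ≡⟨ sym (+-suc ∣ Y ∣ 1) ⟩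
      ∣ Y ∣ + 2
        ≡⟨ cong (∣ Y ∣ +_) (sym (m≤n⇒m⊓n≡m 2≤∣incompleteY∣)) ⟩
      ∣ Y ∣ + 2 ⊓ ∣ incomplete Y ∣
        ≡⟨ sym (rankM-+2 Y) ⟩
      rankM n Y + 2
        ∎)
      where
      open ≡-Reasoning
      2≤∣incompleteY∣ : 2 ≤ ∣ incomplete Y ∣
      2≤∣incompleteY∣ = x∈p∧y∈p∧x≢y⇒2≤∣p∣ (∉⇒classOf∈incomplete e∉Y)
        (⊆classComplement⇒∈incomplete Y⊆C) (Equivalence.to ∈classComplement⇔ e∈C)

    Y≢clY : Y ≢ cl Y
    Y≢clY Y≡clY = e∉Y (subst (e ∈_) (sym Y≡clY) (Equivalence.from (∈cl⇔ (rankM n) {Y}) same-rank))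

    -- Any other circuit contains both elements of class i, and neither lies in Y.
    only-C : ∀ D → IsCircuit D → ∣ D ─ Y ∣ ≡ 1 → D ≡ C
    only-C D D-circuit ∣D─Y∣≡1 =
      let j , D≡Cⱼ = isCircuit⇒≡classComplement D-circuit
          ∣Cⱼ─Y∣≡1 = subst (λ Z → ∣ Z ─ Y ∣ ≡ 1) D≡Cⱼ ∣D─Y∣≡1
      in trans D≡Cⱼ (cong classComplement (decidable-stable (j ≟ᶠ i) λ j≢i →
           <⇒≢ (x∈p∧y∈p∧x≢y⇒2≤∣p∣ (class-i∈ j≢i fz) (class-i∈ j≢i (fs fz)) (combine-0≢combine-1 i))
               (sym ∣Cⱼ─Y∣≡1)))
      where
      class-i∈ : ∀ {j} → j ≢ i → ∀ b → combine i b ∈ classComplement j ─ Y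
      class-i∈ j≢i b =
        x∈p∧x∉q⇒x∈p─q (combine∈classComplement b (j≢i ∘ sym)) (combine∉classComplement i b ∘ Y⊆C)

  circuits-essential : ∀ C → IsCircuit C → Essential (rankM n) C
  circuits-essential C C-circuit =
    let i , C≡Cᵢ = isCircuit⇒≡classComplement C-circuit
    in subst (Essential (rankM n)) (sym C≡Cᵢ) (classComplement-essential i)

corollary2 : (n : ℕ) → n ≥ 3 →
    MatroidNotions.HasUniqueMinimalTropicalBasis (rankM n)
corollary2 (suc (suc (suc m))) (s≤s (s≤s (s≤s z≤n))) =
  circuits-uniqueMinimalTropicalBasis (rankM n) circuits-isTropicalBasis circuits-essential
  where open DoubledDualUniform (suc m)
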